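{- Suppose $\mathcal{H}_1$ is an $(n_1,r_1,s_1)$-system and $\mathcal{H}_2$ is an $(n_2,r_2,s_2)$-system. Then $\mathcal{H}_1\Box\mathcal{H}_2$ is an $\left(n_1n_2,\ r_1r_2,\ \max\{r_1(s_2-1)+1,\ r_2(s_1-1)+1\}\right)$-system.
   Context: For integers $n\ge r\ge s\ge1$, an $(n,r,s)$-system is an $r$-uniform hypergraph on $n$ vertices in which every pair of distinct edges has intersection of size less than $s$. For hypergraphs $\mathcal{H}_1,\mathcal{H}_2$, the direct product $\mathcal{H}_1\Box\mathcal{H}_2$ is the hypergraph on vertex set $V(\mathcal{H}_1)\times V(\mathcal{H}_2)$ with edge set $\{E_1\times E_2: E_1\in\mathcal{H}_1, E_2\in\mathcal{H}_2\}$, where $\times$ is the Cartesian product of sets. -}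

module Defs where

open import Data.Nat using (ℕ; _*_; _≤_; _<_)
open import Data.Fin using (Fin; remQuot)
open import Data.Fin.Subset using (Subset; _∈_; _∩_; ∣_∣)
open import Data.Vec using (tabulate; lookup)
open import Data.Bool using (_∧_)
open import Data.Product using (_×_; proj₁; proj₂; ∃; ∃₂; _,_)
open import Relation.Binary.PropositionalEquality using (_≡_; _≢_)
open import Level using (0ℓ; suc)

Hypergraph : ℕ → Set₁
Hypergraph n = Subset n → Set

IsSystem : (n r s : ℕ) → Hypergraph n → Set
IsSystem n r s H =
  (r ≤ n × s ≤ r × 1 ≤ s)
  × (∀ E → H E → ∣ E ∣ ≡ r)
  × (∀ E F → H E → H F → E ≢ F → ∣ E ∩ F ∣ < s)

-- Cartesian product of vertex subsets, with Fin n₁ × Fin n₂ identified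
-- with Fin (n₁ * n₂) via the standard bijection remQuot / combine.
_×ˢ_ : ∀ {n₁ n₂} → Subset n₁ → Subset n₂ → Subset (n₁ * n₂)
_×ˢ_ {n₁} {n₂} E₁ E₂ =
  tabulate λ i → lookup E₁ (proj₁ (remQuot {n₁} n₂ i)) ∧ lookup E₂ (proj₂ (remQuot {n₁} n₂ i))

_□_ : ∀ {n₁ n₂} → Hypergraph n₁ → Hypergraph n₂ → Hypergraph (n₁ * n₂)
(H₁ □ H₂) E = ∃₂ λ E₁ E₂ → H₁ E₁ × H₂ E₂ × E ≡ E₁ ×ˢ E₂

-- The product edge E₁ × E₂ has r₁ r₂ vertices, and (E₁ × E₂) ∩ (F₁ × F₂) = (E₁ ∩ F₁) × (E₂ ∩ F₂).
-- Distinct product edges differ in some factor: if E₁ ≠ F₁ the intersection has at most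
-- (s₁ − 1) r₂ vertices, and if E₂ ≠ F₂ at most r₁ (s₂ − 1).
module Submission where

open import Defs
open import Algebra.Bundles using (CommutativeMonoid)
open import Data.Bool using (true; false; _∧_)
open import Data.Bool.Properties using (∧-commutativeMonoid)
import Data.Bool.Properties as Bool
open import Data.Fin using (combine; quotient; remainder)
open import Data.Fin.Properties using (combine-remQuot)
open import Data.Fin.Subset using (Subset; _∩_; ∣_∣; ⊥)
open import Data.Fin.Subset.Properties using (∣⊥∣≡0; ∣p∩q∣≤∣p∣)
open import Data.Nat using (ℕ; suc; _*_; _+_; _∸_; _⊔_; _≤_; _<_; z≤n; s≤s)
open import Data.Nat.Properties
open import Data.Empty using (⊥-elim)
open import Data.Product using (_,_)
open import Data.Sum using (_⊎_; inj₁; inj₂)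
open import Data.Vec using (Vec; []; _∷_; _++_; map; concat; lookup; tabulate)
open import Data.Vec.Properties
  using (≡-dec; lookup∘tabulate; tabulate∘lookup; tabulate-cong; lookup-map; lookup-zipWith; lookup-concat; map-id; map-const)
open import Relation.Binary.PropositionalEquality
open import Relation.Nullary using (yes; no)
open import Algebra.Properties.CommutativeSemigroup
  (CommutativeMonoid.commutativeSemigroup ∧-commutativeMonoid) using (interchange)

-- The product laid out row by row; unlike _×ˢ_, whose indices go through remQuot, its
-- cardinality can be computed by recursion on the first factor.
_⊗_ : ∀ {m n} → Subset m → Subset n → Subset (m * n)
A ⊗ B = concat (map (λ a → map (a ∧_) B) A)

lookup-extensionality : ∀ {A : Set} {n} {xs ys : Vec A n} →
  (∀ i → lookup xs i ≡ lookup ys i) → xs ≡ ys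
lookup-extensionality {xs = xs} {ys} eq = begin
  xs                  ≡⟨ tabulate∘lookup xs ⟨
  tabulate (lookup xs) ≡⟨ tabulate-cong eq ⟩
  tabulate (lookup ys) ≡⟨ tabulate∘lookup ys ⟩
  ys                  ∎
  where open ≡-Reasoning

module _ {n₁ n₂ : ℕ} where

  open ≡-Reasoning

  lookup-×ˢ : ∀ (A : Subset n₁) (B : Subset n₂) i →
    lookup (A ×ˢ B) i ≡ lookup A (quotient {n₁} n₂ i) ∧ lookup B (remainder {n₁} n₂ i)
  lookup-×ˢ A B = lookup∘tabulate _

  ×ˢ-∩ : ∀ (A C : Subset n₁) (B D : Subset n₂) →
    (A ×ˢ B) ∩ (C ×ˢ D) ≡ (A ∩ C) ×ˢ (B ∩ D)
  ×ˢ-∩ A C B D = lookup-extensionality λ i →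
    let x = quotient {n₁} n₂ i; y = remainder {n₁} n₂ i in begin
    lookup ((A ×ˢ B) ∩ (C ×ˢ D)) i
      ≡⟨ lookup-zipWith _∧_ i (A ×ˢ B) (C ×ˢ D) ⟩
    lookup (A ×ˢ B) i ∧ lookup (C ×ˢ D) i
      ≡⟨ cong₂ _∧_ (lookup-×ˢ A B i) (lookup-×ˢ C D i) ⟩
    (lookup A x ∧ lookup B y) ∧ (lookup C x ∧ lookup D y)
      ≡⟨ interchange (lookup A x) (lookup B y) (lookup C x) (lookup D y) ⟩
    (lookup A x ∧ lookup C x) ∧ (lookup B y ∧ lookup D y)
      ≡⟨ cong₂ _∧_ (lookup-zipWith _∧_ x A C) (lookup-zipWith _∧_ y B D) ⟨
    lookup (A ∩ C) x ∧ lookup (B ∩ D) y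
      ≡⟨ lookup-×ˢ (A ∩ C) (B ∩ D) i ⟨
    lookup ((A ∩ C) ×ˢ (B ∩ D)) i ∎

  ×ˢ-≡-⊗ : ∀ (A : Subset n₁) (B : Subset n₂) → A ×ˢ B ≡ A ⊗ B
  ×ˢ-≡-⊗ A B = lookup-extensionality λ i →
    let x = quotient {n₁} n₂ i; y = remainder {n₁} n₂ i
        rows = map (λ a → map (a ∧_) B) A in begin
    lookup (A ×ˢ B) i                  ≡⟨ lookup-×ˢ A B i ⟩
    lookup A x ∧ lookup B y            ≡⟨ lookup-map y (lookup A x ∧_) B ⟨
    lookup (map (lookup A x ∧_) B) y   ≡⟨ cong (λ row → lookup row y) (lookup-map x _ A) ⟨
    lookup (lookup rows x) y           ≡⟨ lookup-concat rows x y ⟨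
    lookup (concat rows) (combine x y) ≡⟨ cong (lookup (concat rows)) (combine-remQuot {n₁} n₂ i) ⟩
    lookup (A ⊗ B) i                   ∎

∣p++q∣≡∣p∣+∣q∣ : ∀ {m n} (p : Subset m) (q : Subset n) → ∣ p ++ q ∣ ≡ ∣ p ∣ + ∣ q ∣
∣p++q∣≡∣p∣+∣q∣ []            q = refl
∣p++q∣≡∣p∣+∣q∣ (true  ∷ p) q = cong suc (∣p++q∣≡∣p∣+∣q∣ p q)
∣p++q∣≡∣p∣+∣q∣ (false ∷ p) q = ∣p++q∣≡∣p∣+∣q∣ p q

∣p⊗q∣≡∣p∣*∣q∣ : ∀ {m n} (p : Subset m) (q : Subset n) → ∣ p ⊗ q ∣ ≡ ∣ p ∣ * ∣ q ∣
∣p⊗q∣≡∣p∣*∣q∣ [] q = refl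
∣p⊗q∣≡∣p∣*∣q∣ (true ∷ p) q = begin
  ∣ map (true ∧_) q ++ p ⊗ q ∣      ≡⟨ ∣p++q∣≡∣p∣+∣q∣ (map (true ∧_) q) (p ⊗ q) ⟩
  ∣ map (true ∧_) q ∣ + ∣ p ⊗ q ∣   ≡⟨ cong₂ _+_ (cong ∣_∣ (map-id q)) (∣p⊗q∣≡∣p∣*∣q∣ p q) ⟩
  ∣ q ∣ + ∣ p ∣ * ∣ q ∣             ∎
  where open ≡-Reasoning
∣p⊗q∣≡∣p∣*∣q∣ {n = n} (false ∷ p) q = begin
  ∣ map (false ∧_) q ++ p ⊗ q ∣     ≡⟨ ∣p++q∣≡∣p∣+∣q∣ (map (false ∧_) q) (p ⊗ q) ⟩
  ∣ map (false ∧_) q ∣ + ∣ p ⊗ q ∣  ≡⟨ cong₂ _+_ (cong ∣_∣ (map-const q false)) (∣p⊗q∣≡∣p∣*∣q∣ p q) ⟩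
  ∣ ⊥ {n} ∣ + ∣ p ∣ * ∣ q ∣         ≡⟨ cong (_+ ∣ p ∣ * ∣ q ∣) (∣⊥∣≡0 n) ⟩
  ∣ p ∣ * ∣ q ∣                     ∎
  where open ≡-Reasoning

∣p×ˢq∣≡∣p∣*∣q∣ : ∀ {m n} (p : Subset m) (q : Subset n) → ∣ p ×ˢ q ∣ ≡ ∣ p ∣ * ∣ q ∣
∣p×ˢq∣≡∣p∣*∣q∣ p q = trans (cong ∣_∣ (×ˢ-≡-⊗ p q)) (∣p⊗q∣≡∣p∣*∣q∣ p q)

×ˢ-≢⇒≢⊎≢ : ∀ {m n} {A C : Subset m} {B D : Subset n} → A ×ˢ B ≢ C ×ˢ D → A ≢ C ⊎ B ≢ D
×ˢ-≢⇒≢⊎≢ {A = A} {C} {B} {D} A×B≢C×D with ≡-dec Bool._≟_ A C | ≡-dec Bool._≟_ B D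
... | yes refl | yes refl = ⊥-elim (A×B≢C×D refl)
... | yes _    | no B≢D   = inj₂ B≢D
... | no A≢C   | _        = inj₁ A≢C

m<s⇒n≤r⇒m*n<r*[s∸1]+1 : ∀ {m n r} s → m < s → n ≤ r → m * n < r * (s ∸ 1) + 1
m<s⇒n≤r⇒m*n<r*[s∸1]+1 {m} {n} {r} (suc t) (s≤s m≤t) n≤r = begin-strict
  m * n      ≤⟨ *-mono-≤ m≤t n≤r ⟩
  t * r      ≡⟨ *-comm t r ⟩
  r * t      <⟨ m<m+n (r * t) (s≤s z≤n) ⟩
  r * t + 1  ∎
  where open ≤-Reasoning

r*[s∸1]+1≤r*r′ : ∀ {r r′} s → 1 ≤ r → 1 ≤ s → s ≤ r′ → r * (s ∸ 1) + 1 ≤ r * r′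
r*[s∸1]+1≤r*r′ {r} {r′} (suc t) 1≤r _ s≤r′ = begin
  r * t + 1   ≤⟨ +-monoʳ-≤ (r * t) 1≤r ⟩
  r * t + r   ≡⟨ +-comm (r * t) r ⟩
  r + r * t   ≡⟨ *-suc r t ⟨
  r * suc t   ≤⟨ *-monoʳ-≤ r s≤r′ ⟩
  r * r′      ∎
  where open ≤-Reasoning

∣×ˢ∩×ˢ∣< : ∀ {n₁ n₂ r₁ s₁ r₂ s₂} {A C : Subset n₁} {B D : Subset n₂} →
  ∣ A ∣ ≡ r₁ → ∣ B ∣ ≡ r₂ →
  (A ≢ C → ∣ A ∩ C ∣ < s₁) → (B ≢ D → ∣ B ∩ D ∣ < s₂) →
  A ×ˢ B ≢ C ×ˢ D → ∣ (A ×ˢ B) ∩ (C ×ˢ D) ∣ < (r₁ * (s₂ ∸ 1) + 1) ⊔ (r₂ * (s₁ ∸ 1) + 1)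
∣×ˢ∩×ˢ∣< {s₁ = s₁} {s₂ = s₂} {A = A} {C} {B} {D} refl refl meetA meetB A×B≢C×D
  rewrite ×ˢ-∩ A C B D | ∣p×ˢq∣≡∣p∣*∣q∣ (A ∩ C) (B ∩ D) with ×ˢ-≢⇒≢⊎≢ A×B≢C×D
... | inj₁ A≢C = <-≤-trans
  (m<s⇒n≤r⇒m*n<r*[s∸1]+1 s₁ (meetA A≢C) (∣p∩q∣≤∣p∣ B D))
  (m≤n⊔m _ _)
... | inj₂ B≢D = <-≤-trans
  (subst (_< ∣ A ∣ * (s₂ ∸ 1) + 1) (*-comm ∣ B ∩ D ∣ ∣ A ∩ C ∣)
    (m<s⇒n≤r⇒m*n<r*[s∸1]+1 s₂ (meetB B≢D) (∣p∩q∣≤∣p∣ A C)))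
  (m≤m⊔n _ _)

lemma2p4 : (n₁ r₁ s₁ n₂ r₂ s₂ : ℕ) (H₁ : Hypergraph n₁) (H₂ : Hypergraph n₂)
    → IsSystem n₁ r₁ s₁ H₁ → IsSystem n₂ r₂ s₂ H₂
    → IsSystem (n₁ * n₂) (r₁ * r₂) ((r₁ * (s₂ ∸ 1) + 1) ⊔ (r₂ * (s₁ ∸ 1) + 1)) (H₁ □ H₂)
lemma2p4 n₁ r₁ s₁ n₂ r₂ s₂ H₁ H₂
  ((r₁≤n₁ , s₁≤r₁ , 1≤s₁) , size₁ , meet₁) ((r₂≤n₂ , s₂≤r₂ , 1≤s₂) , size₂ , meet₂) =
  ( *-mono-≤ r₁≤n₁ r₂≤n₂
  , ⊔-lub (r*[s∸1]+1≤r*r′ s₂ (≤-trans 1≤s₁ s₁≤r₁) 1≤s₂ s₂≤r₂)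
          (subst (r₂ * (s₁ ∸ 1) + 1 ≤_) (*-comm r₂ r₁) (r*[s∸1]+1≤r*r′ s₁ (≤-trans 1≤s₂ s₂≤r₂) 1≤s₁ s₁≤r₁))
  , ≤-trans (m≤n+m 1 (r₁ * (s₂ ∸ 1))) (m≤m⊔n _ _) )
  , size
  , meet
  where
  size : ∀ E → (H₁ □ H₂) E → ∣ E ∣ ≡ r₁ * r₂
  size _ (E₁ , E₂ , e₁ , e₂ , refl) =
    trans (∣p×ˢq∣≡∣p∣*∣q∣ E₁ E₂) (cong₂ _*_ (size₁ E₁ e₁) (size₂ E₂ e₂))
  meet : ∀ E F → (H₁ □ H₂) E → (H₁ □ H₂) F → E ≢ F →
    ∣ E ∩ F ∣ < (r₁ * (s₂ ∸ 1) + 1) ⊔ (r₂ * (s₁ ∸ 1) + 1)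
  meet _ _ (E₁ , E₂ , e₁ , e₂ , refl) (F₁ , F₂ , f₁ , f₂ , refl) =
    ∣×ˢ∩×ˢ∣< (size₁ E₁ e₁) (size₂ E₂ e₂) (meet₁ E₁ F₁ e₁ f₁) (meet₂ E₂ F₂ e₂ f₂)
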